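{- Let $G$ be a graph on $n\ge 5$ vertices and $m$ edges. If $G$ is $(n-1)$-critical, then $\frac{n^2-n-n\sqrt{n}}{2}<m\le \frac{(n-1)(n-2)}{2}$.
   Context: Standing assumption of the paper: all graphs are finite, undirected, simple and connected. A star coloring of $G$ is a proper vertex-coloring such that no path on four vertices (as a subgraph) is colored with only two colors; $\chi_s(G)$ is the minimum number of colors in a star coloring of $G$. $G$ is $k$-critical if $\chi_s(G)=k$ and $\chi_s(G-e)<\chi_s(G)$ for every edge $e$, where $G-e$ denotes deletion of the edge $e$. -}

module Defs where

open import Data.Nat using (ℕ; zero; suc; _+_; _*_; _∸_; _≤_; _<_)
open import Data.Fin using (Fin; toℕ; _≟_)
open import Data.Bool using (Bool; true; false; _∧_; _∨_; not; if_then_else_)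
open import Data.Product using (Σ; _×_; ∃; ∃-syntax)
open import Data.Sum using (_⊎_)
open import Relation.Nullary using (¬_)
open import Relation.Nullary.Decidable using (⌊_⌋)
open import Relation.Binary.PropositionalEquality using (_≡_; _≢_)
open import Data.Nat using (_<ᵇ_)
open import Relation.Binary.PropositionalEquality using (refl)
import Data.Bool.Properties
import Data.Fin

record Graph (n : ℕ) : Set where
  field
    adj   : Fin n → Fin n → Bool
    sym   : ∀ u v → adj u v ≡ adj v u
    irref : ∀ v → adj v v ≡ false
open Graph public

Adj : ∀ {n} → Graph n → Fin n → Fin n → Set
Adj G u v = adj G u v ≡ true

data Reach {n : ℕ} (G : Graph n) : Fin n → Fin n → Set where
  here : ∀ {v} → Reach G v v
  step : ∀ {u v w} → Adj G u v → Reach G v w → Reach G u w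

Connected : ∀ {n} → Graph n → Set
Connected G = ∀ u v → Reach G u v

sumFin : (n : ℕ) → (Fin n → ℕ) → ℕ
sumFin zero    f = 0
sumFin (suc n) f = f Fin.zero + sumFin n (λ i → f (Fin.suc i))

numEdges : ∀ {n} → Graph n → ℕ
numEdges {n} G =
  sumFin n (λ i → sumFin n (λ j →
    if (toℕ i <ᵇ toℕ j) ∧ adj G i j then 1 else 0))

boolSwap : ∀ a b c d → (a ∧ b) ∨ (c ∧ d) ≡ (d ∧ c) ∨ (b ∧ a)
boolSwap false false false false = refl
boolSwap false false false true = refl
boolSwap false false true false = refl
boolSwap false false true true = refl
boolSwap false true false false = refl
boolSwap false true false true = refl
boolSwap false true true false = refl
boolSwap false true true true = refl
boolSwap true false false false = refl
boolSwap true false false true = refl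
boolSwap true false true false = refl
boolSwap true false true true = refl
boolSwap true true false false = refl
boolSwap true true false true = refl
boolSwap true true true false = refl
boolSwap true true true true = refl

deleteEdge : ∀ {n} → (G : Graph n) → Fin n → Fin n → Graph n
deleteEdge {n} G u v = record { adj = a ; sym = s ; irref = r }
  where
    hit : Fin n → Fin n → Bool
    hit x y = (⌊ x ≟ u ⌋ ∧ ⌊ y ≟ v ⌋) ∨ (⌊ x ≟ v ⌋ ∧ ⌊ y ≟ u ⌋)
    a : Fin n → Fin n → Bool
    a x y = adj G x y ∧ not (hit x y)
    s : ∀ x y → a x y ≡ a y x
    s x y rewrite sym G x y
                | boolSwap ⌊ x ≟ u ⌋ ⌊ y ≟ v ⌋ ⌊ x ≟ v ⌋ ⌊ y ≟ u ⌋ = refl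
    r : ∀ x → a x x ≡ false
    r x rewrite irref G x = refl

Proper : ∀ {n k} → Graph n → (Fin n → Fin k) → Set
Proper G c = ∀ u v → Adj G u v → c u ≢ c v

TwoColoredP4 : ∀ {n k} → Graph n → (Fin n → Fin k) → Set
TwoColoredP4 {n} {k} G c =
  Σ (Fin n) λ a → Σ (Fin n) λ b → Σ (Fin n) λ c' → Σ (Fin n) λ d →
    (a ≢ b × a ≢ c' × a ≢ d × b ≢ c' × b ≢ d × c' ≢ d) ×
    (Adj G a b × Adj G b c' × Adj G c' d) ×
    Σ (Fin k) λ x → Σ (Fin k) λ y →
      ((c a ≡ x ⊎ c a ≡ y) × (c b ≡ x ⊎ c b ≡ y) ×
       (c c' ≡ x ⊎ c c' ≡ y) × (c d ≡ x ⊎ c d ≡ y))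

IsStarColoring : ∀ {n k} → Graph n → (Fin n → Fin k) → Set
IsStarColoring G c = Proper G c × ¬ TwoColoredP4 G c

StarColorable : ∀ {n} → Graph n → ℕ → Set
StarColorable {n} G k = Σ (Fin n → Fin k) λ c → IsStarColoring G c

StarChromaticNumber : ∀ {n} → Graph n → ℕ → Set
StarChromaticNumber G k = StarColorable G k × (∀ j → StarColorable G j → k ≤ j)

Critical : ∀ {n} → Graph n → ℕ → Set
Critical {n} G k = StarChromaticNumber G k ×
  (∀ u v → Adj G u v → Σ ℕ λ j → StarChromaticNumber (deleteEdge G u v) j × j < k)

-- x < √y for naturals, encoded as x * x < y (equivalent since both sides are ≥ 0)
_<√_ : ℕ → ℕ → Set
x <√ y = x * x < y

{-# OPTIONS --safe #-}
-- Let H be the complement of G and m the number of edges of G. As χ_s(G) = n − 1, G has no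
-- star coloring with n − 2 colors. A triangle of H could be merged into one color class, and a
-- 4-cycle a v b w of H into the two classes {a, v} and {b, w}, giving such a coloring; so H has
-- neither, any two vertices have at most one common H-neighbour, Σ deg_H² ≤ n(n − 1), and
-- Cauchy–Schwarz yields (Σ deg_H)² < n³ with Σ deg_H = n² − n − 2m.
-- Conversely, for an edge rx of G, G − rx has a star coloring with at most n − 2 colors. It has
-- a color class of size three or two of size two, and three edges of G − rx between two classes
-- of size two would form a bicolored P₄; so the complement of G − rx, which is H plus the edge rx,
-- contains a triangle or a 4-cycle, necessarily through rx. Hence r and x are joined in H by a
-- path of length 2 or 3, every vertex is within distance 3 of a fixed root in H, H has at least
-- n − 1 edges, and 2m ≤ n² − n − 2(n − 1) = (n − 1)(n − 2).

module Submission where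

open import Defs hiding (sym)
open import Data.Nat
open import Data.Nat.Properties
open import Data.Nat.Tactic.RingSolver using (solve-∀)
open import Data.Fin as Fin using (Fin; toℕ; punchOut; punchIn) renaming (zero to fzero; suc to fsuc)
import Data.Fin.Properties as Finₚ
open import Data.Bool as Bool using (Bool; true; false; _∧_; _∨_; not; if_then_else_)
import Data.Bool.Properties as Boolₚ
open import Data.Empty using (⊥; ⊥-elim)
open import Data.Product using (Σ; _×_; _,_; proj₁; proj₂)
open import Data.Sum using (_⊎_; inj₁; inj₂; [_,_])
open import Function using (_∘_)
open import Relation.Nullary using (¬_; Dec; yes; no)
open import Relation.Nullary.Decidable using (⌊_⌋; _×-dec_)
open import Relation.Binary.PropositionalEquality hiding ([_])

𝟙 : Bool → ℕ
𝟙 b = if b then 1 else 0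

𝟙-∧ : ∀ a b → 𝟙 a * 𝟙 b ≡ 𝟙 (a ∧ b)
𝟙-∧ true  b = +-identityʳ (𝟙 b)
𝟙-∧ false b = refl

sum-cong : ∀ n {f g : Fin n → ℕ} → (∀ i → f i ≡ g i) → sumFin n f ≡ sumFin n g
sum-cong zero    f≡g = refl
sum-cong (suc n) f≡g = cong₂ _+_ (f≡g fzero) (sum-cong n (f≡g ∘ fsuc))

sum-mono : ∀ n {f g : Fin n → ℕ} → (∀ i → f i ≤ g i) → sumFin n f ≤ sumFin n g
sum-mono zero    f≤g = z≤n
sum-mono (suc n) f≤g = +-mono-≤ (f≤g fzero) (sum-mono n (f≤g ∘ fsuc))

sum-+ : ∀ n (f g : Fin n → ℕ) → sumFin n (λ i → f i + g i) ≡ sumFin n f + sumFin n g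
sum-+ zero    f g = refl
sum-+ (suc n) f g
  rewrite sum-+ n (f ∘ fsuc) (g ∘ fsuc) = interchange (f fzero) (g fzero) _ _
  where
  interchange : ∀ a b c d → a + b + (c + d) ≡ a + c + (b + d)
  interchange = solve-∀

sum-*ˡ : ∀ n k (f : Fin n → ℕ) → sumFin n (λ i → k * f i) ≡ k * sumFin n f
sum-*ˡ zero    k f = sym (*-zeroʳ k)
sum-*ˡ (suc n) k f
  rewrite sum-*ˡ n k (f ∘ fsuc) = sym (*-distribˡ-+ k (f fzero) _)

sum-const : ∀ n k → sumFin n (λ _ → k) ≡ n * k
sum-const zero    k = refl
sum-const (suc n) k = cong (k +_) (sum-const n k)

sum-zero : ∀ n {f : Fin n → ℕ} → (∀ i → f i ≡ 0) → sumFin n f ≡ 0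
sum-zero n f≡0 = trans (sum-cong n f≡0) (trans (sum-const n 0) (*-zeroʳ n))

sum-swap : ∀ n m (f : Fin n → Fin m → ℕ) →
  sumFin n (λ i → sumFin m (f i)) ≡ sumFin m (λ j → sumFin n (λ i → f i j))
sum-swap zero    m f = sym (sum-zero m (λ _ → refl))
sum-swap (suc n) m f = begin
  sumFin m (f fzero) + sumFin n (λ i → sumFin m (f (fsuc i)))
    ≡⟨ cong (sumFin m (f fzero) +_) (sum-swap n m (f ∘ fsuc)) ⟩
  sumFin m (f fzero) + sumFin m (λ j → sumFin n (λ i → f (fsuc i) j))
    ≡⟨ sum-+ m (f fzero) _ ⟨
  sumFin m (λ j → f fzero j + sumFin n (λ i → f (fsuc i) j))
    ∎
  where open ≡-Reasoning

sum-*-sum : ∀ n (f g : Fin n → ℕ) →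
  sumFin n f * sumFin n g ≡ sumFin n (λ i → sumFin n (λ j → f i * g j))
sum-*-sum n f g = begin
  sumFin n f * sumFin n g                       ≡⟨ *-comm (sumFin n f) _ ⟩
  sumFin n g * sumFin n f                       ≡⟨ sum-*ˡ n (sumFin n g) f ⟨
  sumFin n (λ i → sumFin n g * f i)              ≡⟨ sum-cong n (λ i → *-comm (sumFin n g) (f i)) ⟩
  sumFin n (λ i → f i * sumFin n g)              ≡⟨ sum-cong n (λ i → sum-*ˡ n (f i) g) ⟨
  sumFin n (λ i → sumFin n (λ j → f i * g j))   ∎
  where open ≡-Reasoning

term≤sum : ∀ n (f : Fin n → ℕ) i → f i ≤ sumFin n f
term≤sum (suc n) f fzero    = m≤m+n (f fzero) _
term≤sum (suc n) f (fsuc i) = ≤-trans (term≤sum n (f ∘ fsuc) i) (m≤n+m _ (f fzero))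

sum-diagonal : ∀ n (i : Fin n) x → sumFin n (λ j → if ⌊ i Fin.≟ j ⌋ then x else 0) ≡ x
sum-diagonal (suc n) fzero    x = trans (cong (x +_) (sum-zero n (λ _ → refl))) (+-identityʳ x)
sum-diagonal (suc n) (fsuc i) x = trans (sum-cong n shift) (sum-diagonal n i x)
  where
  shift : ∀ j → (if ⌊ fsuc i Fin.≟ fsuc j ⌋ then x else 0) ≡ (if ⌊ i Fin.≟ j ⌋ then x else 0)
  shift j with i Fin.≟ j
  ... | yes _ = refl
  ... | no  _ = refl

count-unique≤1 : ∀ n (p : Fin n → Bool) → (∀ i j → p i ≡ true → p j ≡ true → i ≡ j) →
  sumFin n (𝟙 ∘ p) ≤ 1
count-unique≤1 zero    p unique = z≤n
count-unique≤1 (suc n) p unique with p fzero in p₀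
... | false = count-unique≤1 n (p ∘ fsuc) (λ i j pᵢ pⱼ → Finₚ.suc-injective (unique _ _ pᵢ pⱼ))
... | true  = s≤s (≤-reflexive (sum-zero n others))
  where
  others : ∀ i → 𝟙 (p (fsuc i)) ≡ 0
  others i with p (fsuc i) in pᵢ
  ... | false = refl
  ... | true with () ← unique fzero (fsuc i) p₀ pᵢ

2ab≤a²+b² : ∀ a b → 2 * (a * b) ≤ a * a + b * b
2ab≤a²+b² zero    b       = z≤n
2ab≤a²+b² (suc a) zero    = ≤-trans (≤-reflexive (cong (2 *_) (*-zeroʳ (suc a)))) z≤n
2ab≤a²+b² (suc a) (suc b) = begin
  2 * (suc a * suc b)                  ≡⟨ expand-left a b ⟩
  2 * (a * b) + 2 * (a + b + 1)       ≤⟨ +-monoˡ-≤ _ (2ab≤a²+b² a b) ⟩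
  a * a + b * b + 2 * (a + b + 1)     ≡⟨ expand-right a b ⟩
  suc a * suc a + suc b * suc b       ∎
  where
  open ≤-Reasoning
  expand-left : ∀ a b → 2 * (suc a * suc b) ≡ 2 * (a * b) + 2 * (a + b + 1)
  expand-left = solve-∀
  expand-right : ∀ a b → a * a + b * b + 2 * (a + b + 1) ≡ suc a * suc a + suc b * suc b
  expand-right = solve-∀

cauchy-schwarz : ∀ n (f : Fin n → ℕ) → sumFin n f * sumFin n f ≤ n * sumFin n (λ i → f i * f i)
cauchy-schwarz n f = *-cancelˡ-≤ 2 (begin
  2 * (sumFin n f * sumFin n f)
    ≡⟨ cong (2 *_) (sum-*-sum n f f) ⟩
  2 * sumFin n (λ i → sumFin n (λ j → f i * f j))
    ≡⟨ trans (sum-cong n (λ i → sum-*ˡ n 2 _)) (sum-*ˡ n 2 _) ⟨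
  sumFin n (λ i → sumFin n (λ j → 2 * (f i * f j)))
    ≤⟨ sum-mono n (λ i → sum-mono n (λ j → 2ab≤a²+b² (f i) (f j))) ⟩
  sumFin n (λ i → sumFin n (λ j → f i * f i + f j * f j))
    ≡⟨ sum-cong n (λ i → trans (sum-+ n _ _) (cong (_+ Σf²) (sum-const n _))) ⟩
  sumFin n (λ i → n * (f i * f i) + Σf²)
    ≡⟨ trans (sum-+ n _ _) (cong₂ _+_ (sum-*ˡ n n _) (sum-const n Σf²)) ⟩
  n * Σf² + n * Σf²
    ≡⟨ cong (n * Σf² +_) (+-identityʳ (n * Σf²)) ⟨
  2 * (n * Σf²) ∎)
  where
  open ≤-Reasoning
  Σf² : ℕ
  Σf² = sumFin n (λ i → f i * f i)

complement : ∀ {n} → Graph n → Graph n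
complement {n} G = record { adj = nonadj ; sym = nonadj-sym ; irref = nonadj-irref }
  where
  nonadj : Fin n → Fin n → Bool
  nonadj u v = not (adj G u v) ∧ not ⌊ u Fin.≟ v ⌋
  nonadj-sym : ∀ u v → nonadj u v ≡ nonadj v u
  nonadj-sym u v rewrite Graph.sym G u v with u Fin.≟ v | v Fin.≟ u
  ... | yes _   | yes _   = refl
  ... | no  _   | no  _   = refl
  ... | yes u≡v | no  v≢u = ⊥-elim (v≢u (sym u≡v))
  ... | no  u≢v | yes v≡u = ⊥-elim (u≢v (sym v≡u))
  nonadj-irref : ∀ v → nonadj v v ≡ false
  nonadj-irref v with v Fin.≟ v
  ... | yes _   = Boolₚ.∧-zeroʳ _
  ... | no  v≢v = ⊥-elim (v≢v refl)

degree : ∀ {n} → Graph n → Fin n → ℕ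
degree {n} G v = sumFin n (λ u → 𝟙 (adj G v u))

module _ {n : ℕ} (G : Graph n) where

  Adj-sym : ∀ {u v} → Adj G u v → Adj G v u
  Adj-sym {u} {v} uv = trans (Graph.sym G v u) uv

  Adj⇒≢ : ∀ {u v} → Adj G u v → u ≢ v
  Adj⇒≢ {u} uv refl with () ← trans (sym uv) (irref G u)

  complement⇒nonadjacent : ∀ {u v} → Adj (complement G) u v → adj G u v ≡ false
  complement⇒nonadjacent {u} {v} uv with adj G u v
  ... | false = refl

  complement⇒¬Adj : ∀ {u v} → Adj (complement G) u v → ¬ Adj G u v
  complement⇒¬Adj H-uv G-uv with () ← trans (sym G-uv) (complement⇒nonadjacent H-uv)

  nonadjacent⇒complement : ∀ {u v} → adj G u v ≡ false → u ≢ v → Adj (complement G) u v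
  nonadjacent⇒complement {u} {v} ¬uv u≢v rewrite ¬uv with u Fin.≟ v
  ... | yes u≡v = ⊥-elim (u≢v u≡v)
  ... | no  _   = refl

  adjacent-or-complement : ∀ {u v} → u ≢ v → Adj G u v ⊎ Adj (complement G) u v
  adjacent-or-complement {u} {v} u≢v with adj G u v Bool.≟ true
  ... | yes uv  = inj₁ uv
  ... | no  ¬uv = inj₂ (nonadjacent⇒complement (Boolₚ.¬-not ¬uv) u≢v)

  handshake : sumFin n (degree G) ≡ 2 * numEdges G
  handshake = begin
    sumFin n (degree G)
      ≡⟨ sum-cong n (λ i → trans (sum-cong n (split i)) (sum-+ n _ _)) ⟩
    sumFin n (λ i → forward i + backward i)
      ≡⟨ sum-+ n forward backward ⟩
    numEdges G + sumFin n backward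
      ≡⟨ cong (numEdges G +_) (sum-swap n n (λ i j → 𝟙 (ordered j i))) ⟩
    numEdges G + numEdges G
      ≡⟨ cong (numEdges G +_) (+-identityʳ (numEdges G)) ⟨
    2 * numEdges G ∎
    where
    open ≡-Reasoning
    ordered : Fin n → Fin n → Bool
    ordered i j = (toℕ i <ᵇ toℕ j) ∧ adj G i j
    forward backward : Fin n → ℕ
    forward  i = sumFin n (λ j → 𝟙 (ordered i j))
    backward i = sumFin n (λ j → 𝟙 (ordered j i))
    <ᵇ-total : ∀ x y → x ≢ y → 𝟙 (x <ᵇ y) + 𝟙 (y <ᵇ x) ≡ 1
    <ᵇ-total zero    zero    x≢y = ⊥-elim (x≢y refl)
    <ᵇ-total zero    (suc y) _   = refl
    <ᵇ-total (suc x) zero    _   = refl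
    <ᵇ-total (suc x) (suc y) x≢y = <ᵇ-total x y (x≢y ∘ cong suc)
    split : ∀ i j → 𝟙 (adj G i j) ≡ 𝟙 (ordered i j) + 𝟙 (ordered j i)
    split i j rewrite Graph.sym G j i with adj G i j in ij
    ... | false
      rewrite Boolₚ.∧-zeroʳ (toℕ i <ᵇ toℕ j) | Boolₚ.∧-zeroʳ (toℕ j <ᵇ toℕ i) = refl
    ... | true
      rewrite Boolₚ.∧-identityʳ (toℕ i <ᵇ toℕ j) | Boolₚ.∧-identityʳ (toℕ j <ᵇ toℕ i) =
        sym (<ᵇ-total (toℕ i) (toℕ j) (Adj⇒≢ ij ∘ Finₚ.toℕ-injective))

  degree-complement : ∀ v → degree (complement G) v + degree G v + 1 ≡ n
  degree-complement v = begin
    degree (complement G) v + degree G v + 1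
      ≡⟨ cong (degree (complement G) v + degree G v +_) (sum-diagonal n v 1) ⟨
    degree (complement G) v + degree G v + sumFin n (λ u → 𝟙 ⌊ v Fin.≟ u ⌋)
      ≡⟨ trans (sum-+ n _ _) (cong (_+ _) (sum-+ n _ _)) ⟨
    sumFin n (λ u → 𝟙 (adj (complement G) v u) + 𝟙 (adj G v u) + 𝟙 ⌊ v Fin.≟ u ⌋)
      ≡⟨ sum-cong n trichotomy ⟩
    sumFin n (λ _ → 1)
      ≡⟨ trans (sum-const n 1) (*-identityʳ n) ⟩
    n ∎
    where
    open ≡-Reasoning
    trichotomy : ∀ u → 𝟙 (adj (complement G) v u) + 𝟙 (adj G v u) + 𝟙 ⌊ v Fin.≟ u ⌋ ≡ 1
    trichotomy u with v Fin.≟ u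
    ... | yes refl rewrite irref G v = refl
    ... | no  _ with adj G v u
    ... | true  = refl
    ... | false = refl

  degree-sum-complement : sumFin n (degree (complement G)) + 2 * numEdges G + n ≡ n * n
  degree-sum-complement = begin
    sumFin n (degree (complement G)) + 2 * numEdges G + n
      ≡⟨ cong₂ (λ a b → sumFin n (degree (complement G)) + a + b)
               handshake (trans (sum-const n 1) (*-identityʳ n)) ⟨
    sumFin n (degree (complement G)) + sumFin n (degree G) + sumFin n (λ _ → 1)
      ≡⟨ trans (sum-+ n _ _) (cong (_+ _) (sum-+ n _ _)) ⟨
    sumFin n (λ v → degree (complement G) v + degree G v + 1)
      ≡⟨ sum-cong n degree-complement ⟩
    sumFin n (λ _ → n)
      ≡⟨ sum-const n n ⟩
    n * n ∎
    where open ≡-Reasoning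

Triangle : ∀ {n} → (Fin n → Fin n → Set) → Set
Triangle {n} _~_ = Σ (Fin n) λ a → Σ (Fin n) λ b → Σ (Fin n) λ c → a ~ b × b ~ c × c ~ a

Square : ∀ {n} → (Fin n → Fin n → Set) → Set
Square {n} _~_ = Σ (Fin n) λ a → Σ (Fin n) λ v → Σ (Fin n) λ b → Σ (Fin n) λ w →
  a ≢ b × v ≢ w × a ~ v × v ~ b × b ~ w × w ~ a

module _ {n : ℕ} (H : Graph n) where

  codegree : Fin n → Fin n → ℕ
  codegree a b = sumFin n (λ v → 𝟙 (adj H v a ∧ adj H v b))

  sum-degree² : sumFin n (λ v → degree H v * degree H v) ≡ sumFin n (λ a → sumFin n (codegree a))
  sum-degree² = begin
    sumFin n (λ v → degree H v * degree H v)
      ≡⟨ sum-cong n (λ v → sum-*-sum n _ _) ⟩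
    sumFin n (λ v → sumFin n (λ a → sumFin n (λ b → 𝟙 (adj H v a) * 𝟙 (adj H v b))))
      ≡⟨ sum-cong n (λ v → sum-cong n (λ a → sum-cong n (λ b → 𝟙-∧ (adj H v a) _))) ⟩
    sumFin n (λ v → sumFin n (λ a → sumFin n (λ b → 𝟙 (adj H v a ∧ adj H v b))))
      ≡⟨ sum-swap n n _ ⟩
    sumFin n (λ a → sumFin n (λ v → sumFin n (λ b → 𝟙 (adj H v a ∧ adj H v b))))
      ≡⟨ sum-cong n (λ a → sum-swap n n _) ⟩
    sumFin n (λ a → sumFin n (codegree a)) ∎
    where open ≡-Reasoning

  codegree-self : ∀ a → codegree a a ≡ degree H a
  codegree-self a = sum-cong n λ v → cong 𝟙 (trans (Boolₚ.∧-idem (adj H v a)) (Graph.sym H v a))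

  module _ (noTriangle : ¬ Triangle (Adj H)) (noSquare : ¬ Square (Adj H)) where

    codegree-adjacent : ∀ {a b} → Adj H a b → codegree a b ≡ 0
    codegree-adjacent {a} {b} ab = sum-zero n no-common
      where
      no-common : ∀ v → 𝟙 (adj H v a ∧ adj H v b) ≡ 0
      no-common v with adj H v a in va | adj H v b in vb
      ... | false | _     = refl
      ... | true  | false = refl
      ... | true  | true  = ⊥-elim (noTriangle (a , b , v , ab , Adj-sym H vb , va))

    codegree≤1 : ∀ {a b} → a ≢ b → codegree a b ≤ 1
    codegree≤1 {a} {b} a≢b = count-unique≤1 n _ unique
      where
      unique : ∀ v w → (adj H v a ∧ adj H v b) ≡ true → (adj H w a ∧ adj H w b) ≡ true → v ≡ w
      unique v w vab wab with v Fin.≟ w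
      ... | yes v≡w = v≡w
      ... | no  v≢w with adj H v a in va | adj H v b in vb | adj H w a in wa | adj H w b in wb
      ... | true | true | true | true =
        ⊥-elim (noSquare (a , v , b , w , a≢b , v≢w , Adj-sym H va , vb , Adj-sym H wb , wa))

    codegree-row : ∀ a → sumFin n (codegree a) + 1 ≤ n
    codegree-row a = +-cancelˡ-≤ (degree H a) _ _ (begin
      degree H a + (sumFin n (codegree a) + 1)
        ≡⟨ rearrange (degree H a) (sumFin n (codegree a)) ⟩
      sumFin n (codegree a) + degree H a + 1
        ≡⟨ cong (sumFin n (codegree a) + degree H a +_) (sum-diagonal n a 1) ⟨
      sumFin n (codegree a) + degree H a + sumFin n (λ b → 𝟙 ⌊ a Fin.≟ b ⌋)
        ≡⟨ trans (sum-+ n _ _) (cong (_+ _) (sum-+ n _ _)) ⟨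
      sumFin n (λ b → codegree a b + 𝟙 (adj H a b) + 𝟙 ⌊ a Fin.≟ b ⌋)
        ≤⟨ sum-mono n pointwise ⟩
      sumFin n (λ b → (if ⌊ a Fin.≟ b ⌋ then degree H a else 0) + 1)
        ≡⟨ sum-+ n _ _ ⟩
      sumFin n (λ b → if ⌊ a Fin.≟ b ⌋ then degree H a else 0) + sumFin n (λ _ → 1)
        ≡⟨ cong₂ _+_ (sum-diagonal n a (degree H a)) (trans (sum-const n 1) (*-identityʳ n)) ⟩
      degree H a + n ∎)
      where
      open ≤-Reasoning
      rearrange : ∀ d x → d + (x + 1) ≡ x + d + 1
      rearrange = solve-∀
      pointwise : ∀ b → codegree a b + 𝟙 (adj H a b) + 𝟙 ⌊ a Fin.≟ b ⌋ ≤
                        (if ⌊ a Fin.≟ b ⌋ then degree H a else 0) + 1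
      pointwise b with a Fin.≟ b
      ... | yes refl rewrite irref H a | +-identityʳ (codegree a a) =
        ≤-reflexive (cong (_+ 1) (codegree-self a))
      ... | no a≢b with adj H a b in ab
      ... | true  rewrite codegree-adjacent ab = ≤-refl
      ... | false = ≤-trans (≤-reflexive (trans (+-identityʳ _) (+-identityʳ _))) (codegree≤1 a≢b)

    degree²-bound : sumFin n (λ v → degree H v * degree H v) + n ≤ n * n
    degree²-bound = begin
      sumFin n (λ v → degree H v * degree H v) + n
        ≡⟨ cong₂ _+_ sum-degree² (sym (trans (sum-const n 1) (*-identityʳ n))) ⟩
      sumFin n (λ a → sumFin n (codegree a)) + sumFin n (λ _ → 1)
        ≡⟨ sum-+ n _ _ ⟨
      sumFin n (λ a → sumFin n (codegree a) + 1)
        ≤⟨ sum-mono n codegree-row ⟩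
      sumFin n (λ _ → n)
        ≡⟨ sum-const n n ⟩
      n * n ∎
      where open ≤-Reasoning

Path₂₃ : ∀ {n} → Graph n → Fin n → Fin n → Set
Path₂₃ {n} H r x =
  (Σ (Fin n) λ y → Adj H r y × Adj H y x) ⊎
  (Σ (Fin n) λ y → Σ (Fin n) λ z → Adj H r y × Adj H y z × Adj H z x)

Triangle-map : ∀ {n} {R S : Fin n → Fin n → Set} → (∀ {u v} → R u v → S u v) →
  Triangle R → Triangle S
Triangle-map f (a , b , c , ab , bc , ca) = a , b , c , f ab , f bc , f ca

Square-map : ∀ {n} {R S : Fin n → Fin n → Set} → (∀ {u v} → R u v → S u v) →
  Square R → Square S
Square-map f (a , v , b , w , a≢b , v≢w , av , vb , bw , wa) =
  a , v , b , w , a≢b , v≢w , f av , f vb , f bw , f wa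

module _ {M : ℕ} (H : Graph (suc M)) (layer : Fin (suc M) → ℕ)
         (parent : ∀ i → Σ (Fin (suc M)) λ y → Adj H (fsuc i) y × layer (fsuc i) ≡ suc (layer y))
         where

  private
    N : ℕ
    N = suc M

    downward : Fin N → Fin N → ℕ
    downward x y = 𝟙 (adj H x y ∧ ⌊ layer x ≟ suc (layer y) ⌋)

    T : ℕ
    T = sumFin N (λ x → sumFin N (downward x))

    downward-edge : ∀ x y → Adj H x y → layer x ≡ suc (layer y) → downward x y ≡ 1
    downward-edge x y xy x↓y rewrite xy with layer x ≟ suc (layer y)
    ... | yes _    = refl
    ... | no  x↓̸y = ⊥-elim (x↓̸y x↓y)

    downward-antisym : ∀ x y → downward x y + downward y x ≤ 𝟙 (adj H x y)
    downward-antisym x y rewrite Graph.sym H y x with adj H x y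
    ... | false = z≤n
    ... | true with layer x ≟ suc (layer y) | layer y ≟ suc (layer x)
    ... | yes x↓y | yes y↓x = ⊥-elim (m≢1+n+m (layer x) {1} (trans x↓y (cong suc y↓x)))
    ... | yes _   | no  _   = ≤-refl
    ... | no  _   | yes _   = ≤-refl
    ... | no  _   | no  _   = z≤n

    M≤T : M ≤ T
    M≤T = begin
      M                                          ≡⟨ trans (sum-const M 1) (*-identityʳ M) ⟨
      sumFin M (λ _ → 1)                         ≤⟨ sum-mono M has-parent ⟩
      sumFin M (λ i → sumFin N (downward (fsuc i))) ≤⟨ m≤n+m _ (sumFin N (downward fzero)) ⟩
      T                                          ∎
      where
      open ≤-Reasoning
      has-parent : ∀ i → 1 ≤ sumFin N (downward (fsuc i))
      has-parent i with parent i
      ... | y , iy , i↓y =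
        ≤-trans (≤-reflexive (sym (downward-edge (fsuc i) y iy i↓y))) (term≤sum N (downward (fsuc i)) y)

    T+T≤degree-sum : T + T ≤ sumFin N (degree H)
    T+T≤degree-sum = begin
      T + T
        ≡⟨ cong (T +_) (sum-swap N N (λ x y → downward y x)) ⟨
      T + sumFin N (λ x → sumFin N (λ y → downward y x))
        ≡⟨ sum-+ N (λ x → sumFin N (downward x)) (λ x → sumFin N (λ y → downward y x)) ⟨
      sumFin N (λ x → sumFin N (downward x) + sumFin N (λ y → downward y x))
        ≡⟨ sum-cong N (λ x → sum-+ N (downward x) (λ y → downward y x)) ⟨
      sumFin N (λ x → sumFin N (λ y → downward x y + downward y x))
        ≤⟨ sum-mono N (λ x → sum-mono N (downward-antisym x)) ⟩
      sumFin N (degree H) ∎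
      where open ≤-Reasoning

  degree-sum-≥-parents : 2 * M ≤ sumFin N (degree H)
  degree-sum-≥-parents =
    ≤-trans (≤-reflexive (cong (M +_) (+-identityʳ M))) (≤-trans (+-mono-≤ M≤T M≤T) T+T≤degree-sum)

module _ {n : ℕ} (H : Graph n) (r : Fin n) where

  private
    TwoSteps : Fin n → Set
    TwoSteps x = Σ (Fin n) λ y → Adj H r y × Adj H y x

    two-steps? : ∀ x → Dec (TwoSteps x)
    two-steps? x = Finₚ.any? λ y → (adj H r y Bool.≟ true) ×-dec (adj H y x Bool.≟ true)

  distance≤3 : Fin n → ℕ
  distance≤3 x with x Fin.≟ r | adj H r x | two-steps? x
  ... | yes _ | _     | _     = 0
  ... | no  _ | true  | _     = 1
  ... | no  _ | false | yes _ = 2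
  ... | no  _ | false | no  _ = 3

  private
    distance-root : distance≤3 r ≡ 0
    distance-root with r Fin.≟ r
    ... | yes _   = refl
    ... | no  r≢r = ⊥-elim (r≢r refl)

    distance-one : ∀ {x} → Adj H r x → distance≤3 x ≡ 1
    distance-one {x} rx with x Fin.≟ r
    ... | yes x≡r = ⊥-elim (Adj⇒≢ H rx (sym x≡r))
    ... | no  _   rewrite rx = refl

    distance-two : ∀ {x} → x ≢ r → adj H r x ≡ false → TwoSteps x → distance≤3 x ≡ 2
    distance-two {x} x≢r ¬rx two with x Fin.≟ r
    ... | yes x≡r = ⊥-elim (x≢r x≡r)
    ... | no  _   rewrite ¬rx with two-steps? x
    ...   | yes _    = refl
    ...   | no  ¬two = ⊥-elim (¬two two)

  parent-within-3 : (∀ x → x ≢ r → Adj H r x ⊎ Path₂₃ H r x) →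
    ∀ x → x ≢ r → Σ (Fin n) λ y → Adj H x y × distance≤3 x ≡ suc (distance≤3 y)
  parent-within-3 near x x≢r with x Fin.≟ r | adj H r x in rx | two-steps? x
  ... | yes x≡r | _     | _ = ⊥-elim (x≢r x≡r)
  ... | no  _   | true  | _ = r , Adj-sym H {r} {x} rx , cong suc (sym distance-root)
  ... | no  _   | false | yes (y , ry , yx) = y , Adj-sym H yx , cong suc (sym (distance-one ry))
  ... | no  _   | false | no ¬two with near x x≢r
  ...   | inj₁ rx′ with () ← trans (sym rx′) rx
  ...   | inj₂ (inj₁ two) = ⊥-elim (¬two two)
  ...   | inj₂ (inj₂ (y , z , ry , yz , zx)) =
    z , Adj-sym H zx , cong suc (sym (distance-two z≢r ¬rz (y , ry , yz)))
    where
    z≢r : z ≢ r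
    z≢r refl with () ← trans (sym zx) rx
    ¬rz : adj H r z ≡ false
    ¬rz with adj H r z in rz
    ... | false = refl
    ... | true  = ⊥-elim (¬two (z , rz , zx))

degree-sum-within-3 : ∀ {M} (H : Graph (suc M)) →
  (∀ x → x ≢ fzero → Adj H fzero x ⊎ Path₂₃ H fzero x) → 2 * M ≤ sumFin (suc M) (degree H)
degree-sum-within-3 H near =
  degree-sum-≥-parents H (distance≤3 H fzero) (λ i → parent-within-3 H fzero near (fsuc i) λ ())

OneOf : ∀ {A : Set} → A → A → A → Set
OneOf a b u = u ≡ a ⊎ u ≡ b

module _ {A : Set} {a b : A} where

  OneOf-distinct : ∀ {u w} → OneOf a b u → OneOf a b w → u ≢ w →
    (u ≡ a × w ≡ b) ⊎ (u ≡ b × w ≡ a)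
  OneOf-distinct (inj₁ refl) (inj₁ refl) u≢w = ⊥-elim (u≢w refl)
  OneOf-distinct (inj₁ u≡a)  (inj₂ w≡b)  _   = inj₁ (u≡a , w≡b)
  OneOf-distinct (inj₂ u≡b)  (inj₁ w≡a)  _   = inj₂ (u≡b , w≡a)
  OneOf-distinct (inj₂ refl) (inj₂ refl) u≢w = ⊥-elim (u≢w refl)

  OneOf-cover : ∀ {u w z} → OneOf a b u → OneOf a b w → u ≢ w → OneOf a b z → OneOf u w z
  OneOf-cover u w u≢w (inj₁ refl) with OneOf-distinct u w u≢w
  ... | inj₁ (refl , _) = inj₁ refl
  ... | inj₂ (_ , refl) = inj₂ refl
  OneOf-cover u w u≢w (inj₂ refl) with OneOf-distinct u w u≢w
  ... | inj₁ (_ , refl) = inj₂ refl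
  ... | inj₂ (refl , _) = inj₁ refl

two-colors-alternate : ∀ {A : Set} {p q s x y : A} → p ≢ q → q ≢ s →
  OneOf x y p → OneOf x y q → OneOf x y s → p ≡ s
two-colors-alternate p≢q q≢s p q s with OneOf-distinct p q p≢q | OneOf-distinct q s q≢s
... | inj₁ (refl , _) | inj₁ (refl , _) = ⊥-elim (p≢q refl)
... | inj₁ (p≡x , _)  | inj₂ (_ , s≡x)  = trans p≡x (sym s≡x)
... | inj₂ (p≡y , _)  | inj₁ (_ , s≡y)  = trans p≡y (sym s≡y)
... | inj₂ (refl , _) | inj₂ (refl , _) = ⊥-elim (p≢q refl)

module _ {n k : ℕ} (G : Graph n) (c : Fin n → Fin k) where

  star-coloring-criterion : Proper G c →
    (∀ {w₁ w₂ w₃ w₄} → w₁ ≢ w₃ → c w₁ ≡ c w₃ → w₂ ≢ w₄ → c w₂ ≡ c w₄ → c w₁ ≢ c w₂ →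
       Adj G w₁ w₂ → Adj G w₂ w₃ → ⊥) →
    IsStarColoring G c
  star-coloring-criterion proper no-cross = proper , no-P₄
    where
    no-P₄ : ¬ TwoColoredP4 G c
    no-P₄ (w₁ , w₂ , w₃ , w₄ , (_ , w₁≢w₃ , _ , _ , w₂≢w₄ , _) , (w₁w₂ , w₂w₃ , w₃w₄) ,
           _ , _ , (c₁ , c₂ , c₃ , c₄)) =
      no-cross w₁≢w₃ (two-colors-alternate (proper _ _ w₁w₂) (proper _ _ w₂w₃) c₁ c₂ c₃)
               w₂≢w₄ (two-colors-alternate (proper _ _ w₂w₃) (proper _ _ w₃w₄) c₂ c₃ c₄)
               (proper _ _ w₁w₂) w₁w₂ w₂w₃

module _ {k : ℕ} {s t : Fin (suc (suc k))} (s≢t : s ≢ t) where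

  private
    N : ℕ
    N = suc (suc k)

  coloring-of-fibres : (r : Fin N → Fin N) → (∀ u → r u ≢ s) → (∀ u → r u ≢ t) →
    Σ (Fin N → Fin k) λ c → (∀ u w → c u ≡ c w → r u ≡ r w) × (∀ u w → r u ≡ r w → c u ≡ c w)
  coloring-of-fibres r r≢s r≢t = c , reflects , respects
    where
    dropT : Fin N → Fin (suc k)
    dropT u = punchOut (≢-sym (r≢t u))
    s′ : Fin (suc k)
    s′ = punchOut (≢-sym s≢t)
    dropT≢s′ : ∀ u → s′ ≢ dropT u
    dropT≢s′ u eq = r≢s u (sym (Finₚ.punchOut-injective (≢-sym s≢t) (≢-sym (r≢t u)) eq))
    c : Fin N → Fin k
    c u = punchOut (dropT≢s′ u)
    reflects : ∀ u w → c u ≡ c w → r u ≡ r w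
    reflects u w eq = Finₚ.punchOut-injective (≢-sym (r≢t u)) (≢-sym (r≢t w))
                        (Finₚ.punchOut-injective (dropT≢s′ u) (dropT≢s′ w) eq)
    respects : ∀ u w → r u ≡ r w → c u ≡ c w
    respects u w eq = Finₚ.punchOut-cong s′ (Finₚ.punchOut-cong t eq)

module _ {n : ℕ} (a b t₁ t₂ : Fin n) where

  redirect : Fin n → Fin n
  redirect u with u Fin.≟ a | u Fin.≟ b
  ... | yes _ | _     = t₁
  ... | no  _ | yes _ = t₂
  ... | no  _ | no  _ = u

  redirect-view : ∀ u →
    (u ≡ a × redirect u ≡ t₁) ⊎ (u ≡ b × redirect u ≡ t₂) ⊎ (u ≢ a × u ≢ b × redirect u ≡ u)
  redirect-view u with u Fin.≟ a | u Fin.≟ b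
  ... | yes u≡a | _       = inj₁ (u≡a , refl)
  ... | no  _   | yes u≡b = inj₂ (inj₁ (u≡b , refl))
  ... | no  u≢a | no  u≢b = inj₂ (inj₂ (u≢a , u≢b , refl))

  redirect-avoids : ∀ {s} → OneOf a b s → t₁ ≢ s → t₂ ≢ s → ∀ u → redirect u ≢ s
  redirect-avoids s∈ab t₁≢s t₂≢s u with redirect-view u
  ... | inj₁ (_ , eq)                = subst (_≢ _) (sym eq) t₁≢s
  ... | inj₂ (inj₁ (_ , eq))         = subst (_≢ _) (sym eq) t₂≢s
  ... | inj₂ (inj₂ (u≢a , u≢b , eq)) with s∈ab
  ...   | inj₁ s≡a = λ ru≡s → u≢a (trans (sym eq) (trans ru≡s s≡a))
  ...   | inj₂ s≡b = λ ru≡s → u≢b (trans (sym eq) (trans ru≡s s≡b))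

  redirect-fibre : ∀ {u w} → u ≢ w → redirect u ≡ redirect w →
    (OneOf a t₁ u × redirect u ≡ t₁) ⊎ (OneOf b t₂ u × redirect u ≡ t₂)
  redirect-fibre {u} {w} u≢w eq with redirect-view u | redirect-view w
  ... | inj₁ (u≡a , ru)          | _ = inj₁ (inj₁ u≡a , ru)
  ... | inj₂ (inj₁ (u≡b , ru))   | _ = inj₂ (inj₁ u≡b , ru)
  ... | inj₂ (inj₂ (_ , _ , ru)) | inj₁ (_ , rw) =
    inj₁ (inj₂ (trans (sym ru) (trans eq rw)) , trans eq rw)
  ... | inj₂ (inj₂ (_ , _ , ru)) | inj₂ (inj₁ (_ , rw)) =
    inj₂ (inj₂ (trans (sym ru) (trans eq rw)) , trans eq rw)
  ... | inj₂ (inj₂ (_ , _ , ru)) | inj₂ (inj₂ (_ , _ , rw)) =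
    ⊥-elim (u≢w (trans (sym ru) (trans eq rw)))

module _ {n : ℕ} (G : Graph n) where

  OneOf-adjacent : ∀ {p q u w} → Adj G p q → OneOf p q u → OneOf p q w → u ≢ w → Adj G u w
  OneOf-adjacent pq u w u≢w with OneOf-distinct u w u≢w
  ... | inj₁ (refl , refl) = pq
  ... | inj₂ (refl , refl) = Adj-sym G pq

  complement-blocks : ∀ {w₁ w₂ w₃ z} → Adj (complement G) w₂ z → OneOf w₁ w₃ z →
    Adj G w₁ w₂ → Adj G w₂ w₃ → ⊥
  complement-blocks w₂z (inj₁ refl) w₁w₂ _    = complement⇒¬Adj G w₂z (Adj-sym G w₁w₂)
  complement-blocks w₂z (inj₂ refl) _    w₂w₃ = complement⇒¬Adj G w₂z w₂w₃

module _ {k : ℕ} (G : Graph (suc (suc k))) where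

  private
    H : Graph (suc (suc k))
    H = complement G

    redirect-coloring : ∀ {a b t₁ t₂} → a ≢ b → t₁ ≢ a → t₂ ≢ a → t₁ ≢ b → t₂ ≢ b →
      Σ (Fin (suc (suc k)) → Fin k) λ c →
        (∀ u w → c u ≡ c w → redirect a b t₁ t₂ u ≡ redirect a b t₁ t₂ w) ×
        (∀ u w → redirect a b t₁ t₂ u ≡ redirect a b t₁ t₂ w → c u ≡ c w)
    redirect-coloring {a} {b} {t₁} {t₂} a≢b t₁≢a t₂≢a t₁≢b t₂≢b =
      coloring-of-fibres a≢b (redirect a b t₁ t₂)
        (redirect-avoids a b t₁ t₂ (inj₁ refl) t₁≢a t₂≢a)
        (redirect-avoids a b t₁ t₂ (inj₂ refl) t₁≢b t₂≢b)

  star-colorable-of-complement-triangle : Triangle (Adj H) → StarColorable G k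
  star-colorable-of-complement-triangle (a , b , t , ab , bt , ta)
    with c , reflects , respects ← redirect-coloring (Adj⇒≢ H ab) (Adj⇒≢ H ta) (Adj⇒≢ H ta)
                                     (≢-sym (Adj⇒≢ H bt)) (≢-sym (Adj⇒≢ H bt))
    = c , star-coloring-criterion G c proper no-cross
    where
    r : Fin (suc (suc k)) → Fin (suc (suc k))
    r = redirect a b t t

    across : ∀ {u w} → OneOf a t u → OneOf b t w → u ≢ w → Adj H u w
    across (inj₁ refl) (inj₁ refl) _   = ab
    across (inj₁ refl) (inj₂ refl) _   = Adj-sym H ta
    across (inj₂ refl) (inj₁ refl) _   = Adj-sym H bt
    across (inj₂ refl) (inj₂ refl) u≢w = ⊥-elim (u≢w refl)

    clique : ∀ {u w} → u ≢ w → r u ≡ r w → Adj H u w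
    clique u≢w eq with redirect-fibre a b t t u≢w eq | redirect-fibre a b t t (≢-sym u≢w) (sym eq)
    ... | inj₁ (u∈at , _) | inj₁ (w∈at , _) = OneOf-adjacent H (Adj-sym H ta) u∈at w∈at u≢w
    ... | inj₂ (u∈bt , _) | inj₂ (w∈bt , _) = OneOf-adjacent H bt u∈bt w∈bt u≢w
    ... | inj₁ (u∈at , _) | inj₂ (w∈bt , _) = across u∈at w∈bt u≢w
    ... | inj₂ (u∈bt , _) | inj₁ (w∈at , _) = Adj-sym H (across w∈at u∈bt (≢-sym u≢w))

    apex : ∀ {u w} → u ≢ w → r u ≡ r w → r u ≡ t
    apex u≢w eq with redirect-fibre a b t t u≢w eq
    ... | inj₁ (_ , ru) = ru
    ... | inj₂ (_ , ru) = ru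

    proper : Proper G c
    proper u w uw cu≡cw = complement⇒¬Adj G (clique (Adj⇒≢ G uw) (reflects u w cu≡cw)) uw

    no-cross : ∀ {w₁ w₂ w₃ w₄} → w₁ ≢ w₃ → c w₁ ≡ c w₃ → w₂ ≢ w₄ → c w₂ ≡ c w₄ → c w₁ ≢ c w₂ →
      Adj G w₁ w₂ → Adj G w₂ w₃ → ⊥
    no-cross {w₁} {w₂} {w₃} {w₄} w₁≢w₃ c₁₃ w₂≢w₄ c₂₄ c₁≢c₂ _ _ =
      c₁≢c₂ (respects w₁ w₂ (trans (apex w₁≢w₃ (reflects w₁ w₃ c₁₃))
                                   (sym (apex w₂≢w₄ (reflects w₂ w₄ c₂₄)))))

  star-colorable-of-complement-square : Square (Adj H) → StarColorable G k
  star-colorable-of-complement-square (a , v , b , w , a≢b , v≢w , av , vb , bw , wa)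
    with c , reflects , respects ← redirect-coloring a≢b (≢-sym (Adj⇒≢ H av)) (Adj⇒≢ H wa)
                                     (Adj⇒≢ H vb) (≢-sym (Adj⇒≢ H bw))
    = c , star-coloring-criterion G c proper no-cross
    where
    r : Fin (suc (suc k)) → Fin (suc (suc k))
    r = redirect a b v w

    Class : Fin (suc (suc k)) → Fin (suc (suc k)) → Set
    Class u u′ = (OneOf a v u × OneOf a v u′ × r u ≡ v) ⊎ (OneOf b w u × OneOf b w u′ × r u ≡ w)

    class : ∀ {u u′} → u ≢ u′ → r u ≡ r u′ → Class u u′
    class u≢u′ eq
      with redirect-fibre a b v w u≢u′ eq | redirect-fibre a b v w (≢-sym u≢u′) (sym eq)
    ... | inj₁ (u∈av , ru) | inj₁ (u′∈av , _)  = inj₁ (u∈av , u′∈av , ru)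
    ... | inj₂ (u∈bw , ru) | inj₂ (u′∈bw , _)  = inj₂ (u∈bw , u′∈bw , ru)
    ... | inj₁ (_ , ru)    | inj₂ (_ , ru′)    = ⊥-elim (v≢w (trans (sym ru) (trans eq ru′)))
    ... | inj₂ (_ , ru)    | inj₁ (_ , ru′)    = ⊥-elim (v≢w (trans (sym ru′) (trans (sym eq) ru)))

    proper : Proper G c
    proper u u′ uu′ cu≡cu′ with class (Adj⇒≢ G uu′) (reflects u u′ cu≡cu′)
    ... | inj₁ (u∈av , u′∈av , _) =
      complement⇒¬Adj G (OneOf-adjacent H av u∈av u′∈av (Adj⇒≢ G uu′)) uu′
    ... | inj₂ (u∈bw , u′∈bw , _) =
      complement⇒¬Adj G (OneOf-adjacent H bw u∈bw u′∈bw (Adj⇒≢ G uu′)) uu′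

    neighbour-in-av : ∀ {z} → OneOf b w z → Σ (Fin (suc (suc k))) λ z′ → OneOf a v z′ × Adj H z z′
    neighbour-in-av (inj₁ refl) = v , inj₂ refl , Adj-sym H vb
    neighbour-in-av (inj₂ refl) = a , inj₁ refl , wa

    neighbour-in-bw : ∀ {z} → OneOf a v z → Σ (Fin (suc (suc k))) λ z′ → OneOf b w z′ × Adj H z z′
    neighbour-in-bw (inj₁ refl) = w , inj₂ refl , Adj-sym H wa
    neighbour-in-bw (inj₂ refl) = b , inj₁ refl , vb

    no-cross : ∀ {w₁ w₂ w₃ w₄} → w₁ ≢ w₃ → c w₁ ≡ c w₃ → w₂ ≢ w₄ → c w₂ ≡ c w₄ → c w₁ ≢ c w₂ →
      Adj G w₁ w₂ → Adj G w₂ w₃ → ⊥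
    no-cross {w₁} {w₂} {w₃} {w₄} w₁≢w₃ c₁₃ w₂≢w₄ c₂₄ c₁≢c₂ w₁w₂ w₂w₃
      with class w₁≢w₃ (reflects w₁ w₃ c₁₃) | class w₂≢w₄ (reflects w₂ w₄ c₂₄)
    ... | inj₁ (_ , _ , r₁) | inj₁ (_ , _ , r₂) = c₁≢c₂ (respects w₁ w₂ (trans r₁ (sym r₂)))
    ... | inj₂ (_ , _ , r₁) | inj₂ (_ , _ , r₂) = c₁≢c₂ (respects w₁ w₂ (trans r₁ (sym r₂)))
    ... | inj₁ (w₁∈av , w₃∈av , _) | inj₂ (w₂∈bw , _ , _)
      with z , z∈av , w₂z ← neighbour-in-av w₂∈bw
      = complement-blocks G w₂z (OneOf-cover w₁∈av w₃∈av w₁≢w₃ z∈av) w₁w₂ w₂w₃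
    ... | inj₂ (w₁∈bw , w₃∈bw , _) | inj₁ (w₂∈av , _ , _)
      with z , z∈bw , w₂z ← neighbour-in-bw w₂∈av
      = complement-blocks G w₂z (OneOf-cover w₁∈bw w₃∈bw w₁≢w₃ z∈bw) w₁w₂ w₂w₃

module _ {n k : ℕ} (G : Graph n) {c : Fin n → Fin k} (star : IsStarColoring G c) where

  private
    H : Graph n
    H = complement G

  same-color⇒complement : ∀ {u w} → u ≢ w → c u ≡ c w → Adj H u w
  same-color⇒complement {u} {w} u≢w cu≡cw =
    nonadjacent⇒complement G (Boolₚ.¬-not λ uw → proj₁ star u w uw cu≡cw) u≢w

  record AlternatingSquare (a p b q : Fin n) : Set where
    field
      a≢p : a ≢ p
      a≢b : a ≢ b
      a≢q : a ≢ q
      p≢b : p ≢ b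
      p≢q : p ≢ q
      b≢q : b ≢ q
      ca≡cb : c a ≡ c b
      cp≡cq : c p ≡ c q

  private
    rotate : ∀ {a p b q} → AlternatingSquare a p b q → AlternatingSquare p b q a
    rotate sq = record
      { a≢p = p≢b ; a≢b = p≢q ; a≢q = ≢-sym a≢p
      ; p≢b = b≢q ; p≢q = ≢-sym a≢b ; b≢q = ≢-sym a≢q
      ; ca≡cb = cp≡cq ; cp≡cq = sym ca≡cb }
      where open AlternatingSquare sq

    no-P₄-around : ∀ {a p b q} → AlternatingSquare a p b q → Adj G a p → Adj G p b → Adj G b q → ⊥
    no-P₄-around {a} {p} sq ap pb bq = proj₂ star
      (_ , _ , _ , _ , (a≢p , a≢b , a≢q , p≢b , p≢q , b≢q) , (ap , pb , bq) ,
       c a , c p , inj₁ refl , inj₂ refl , inj₁ (sym ca≡cb) , inj₂ (sym cp≡cq))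
      where open AlternatingSquare sq

    -- With ap missing, pb or bq missing closes a triangle or a 4-cycle in H; otherwise qa is
    -- missing, since p b q a would be a bicolored P₄.
    from-missing-edge : ∀ {a p b q} → AlternatingSquare a p b q → Adj H a p →
      Triangle (Adj H) ⊎ Square (Adj H)
    from-missing-edge {a} {p} {b} {q} sq ap =
      split (adjacent-or-complement G p≢b) (adjacent-or-complement G b≢q)
            (adjacent-or-complement G (≢-sym a≢q))
      where
      open AlternatingSquare sq
      ba : Adj H b a
      ba = same-color⇒complement (≢-sym a≢b) (sym ca≡cb)
      pq : Adj H p q
      pq = same-color⇒complement p≢q cp≡cq
      split : Adj G p b ⊎ Adj H p b → Adj G b q ⊎ Adj H b q → Adj G q a ⊎ Adj H q a →
        Triangle (Adj H) ⊎ Square (Adj H)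
      split (inj₂ pb) _        _        = inj₁ (a , p , b , ap , pb , ba)
      split (inj₁ _)  (inj₂ bq) _       = inj₂ (a , p , q , b , a≢q , p≢b , ap , pq , Adj-sym H bq , ba)
      split (inj₁ _)  (inj₁ _) (inj₂ qa) = inj₁ (q , a , p , qa , ap , pq)
      split (inj₁ pb) (inj₁ bq) (inj₁ qa) = ⊥-elim (no-P₄-around (rotate sq) pb bq qa)

  alternating-square⇒triangle-or-square : ∀ {a p b q} → AlternatingSquare a p b q →
    Triangle (Adj H) ⊎ Square (Adj H)
  alternating-square⇒triangle-or-square sq
    with adjacent-or-complement G a≢p | adjacent-or-complement G p≢b | adjacent-or-complement G b≢q
    where open AlternatingSquare sq
  ... | inj₂ ap | _       | _       = from-missing-edge sq ap
  ... | inj₁ _  | inj₂ pb | _       = from-missing-edge (rotate sq) pb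
  ... | inj₁ _  | inj₁ _  | inj₂ bq = from-missing-edge (rotate (rotate sq)) bq
  ... | inj₁ ap | inj₁ pb | inj₁ bq = ⊥-elim (no-P₄-around sq ap pb bq)

few-colors⇒complement-triangle-or-square : ∀ {M j} (G : Graph (suc M)) {c : Fin (suc M) → Fin j} →
  j < M → IsStarColoring G c → Triangle (Adj (complement G)) ⊎ Square (Adj (complement G))
few-colors⇒complement-triangle-or-square {M} G {c} j<M star
  with a , b , a<b , ca≡cb ← Finₚ.pigeonhole (m<n⇒m<1+n j<M) c
  with p′ , q′ , p′<q′ , cp≡cq ← Finₚ.pigeonhole j<M (c ∘ punchIn a)
  = split-on-b (b Fin.≟ p) (b Fin.≟ q)
  where
  p q : Fin (suc M)
  p = punchIn a p′
  q = punchIn a q′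
  a≢b : a ≢ b
  a≢b = Finₚ.<⇒≢ a<b
  p≢q : p ≢ q
  p≢q = Finₚ.<⇒≢ p′<q′ ∘ Finₚ.punchIn-injective a p′ q′
  a≢p : a ≢ p
  a≢p = ≢-sym (Finₚ.punchInᵢ≢i a p′)
  a≢q : a ≢ q
  a≢q = ≢-sym (Finₚ.punchInᵢ≢i a q′)
  edge : ∀ {u w} → u ≢ w → c u ≡ c w → Adj (complement G) u w
  edge = same-color⇒complement G star
  split-on-b : Dec (b ≡ p) → Dec (b ≡ q) → Triangle (Adj (complement G)) ⊎ Square (Adj (complement G))
  split-on-b (yes refl) _ =
    inj₁ (a , b , q , edge a≢b ca≡cb , edge p≢q cp≡cq , edge (≢-sym a≢q) (sym (trans ca≡cb cp≡cq)))
  split-on-b (no _) (yes refl) =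
    inj₁ (a , b , p , edge a≢b ca≡cb , edge (≢-sym p≢q) (sym cp≡cq) ,
          edge (≢-sym a≢p) (sym (trans ca≡cb (sym cp≡cq))))
  split-on-b (no b≢p) (no b≢q) = alternating-square⇒triangle-or-square G star {a} {p} {b} {q} record
    { a≢p = a≢p ; a≢b = a≢b ; a≢q = a≢q ; p≢b = ≢-sym b≢p ; p≢q = p≢q ; b≢q = b≢q
    ; ca≡cb = ca≡cb ; cp≡cq = cp≡cq }

IsEdge : ∀ {n} → Fin n → Fin n → Fin n → Fin n → Set
IsEdge r x u v = (u ≡ r × v ≡ x) ⊎ (u ≡ x × v ≡ r)

AdjOrEdge : ∀ {n} → Graph n → Fin n → Fin n → Fin n → Fin n → Set
AdjOrEdge H r x u v = Adj H u v ⊎ IsEdge r x u v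

private
  ∧-not≡false : ∀ a b → a ∧ not b ≡ false → a ≡ false ⊎ b ≡ true
  ∧-not≡false false _    _ = inj₁ refl
  ∧-not≡false true  true _ = inj₂ refl

  both : ∀ {P Q : Set} (p : Dec P) (q : Dec Q) → (⌊ p ⌋ ∧ ⌊ q ⌋) ≡ true → P × Q
  both (yes p) (yes q) _ = p , q

complement-deleteEdge : ∀ {n} (G : Graph n) (r x : Fin n) {u v} →
  Adj (complement (deleteEdge G r x)) u v → AdjOrEdge (complement G) r x u v
complement-deleteEdge G r x {u} {v} uv
  with ∧-not≡false (adj G u v) _ (complement⇒nonadjacent (deleteEdge G r x) uv)
... | inj₁ ¬uv = inj₁ (nonadjacent⇒complement G ¬uv (Adj⇒≢ (complement (deleteEdge G r x)) uv))
... | inj₂ hit = inj₂ (deleted hit)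
  where
  deleted : ((⌊ u Fin.≟ r ⌋ ∧ ⌊ v Fin.≟ x ⌋) ∨ (⌊ u Fin.≟ x ⌋ ∧ ⌊ v Fin.≟ r ⌋)) ≡ true →
    IsEdge r x u v
  deleted hit with u Fin.≟ r | v Fin.≟ x
  ... | yes u≡r | yes v≡x = inj₁ (u≡r , v≡x)
  ... | yes _   | no  _   = inj₂ (both (u Fin.≟ x) (v Fin.≟ r) hit)
  ... | no  _   | _       = inj₂ (both (u Fin.≟ x) (v Fin.≟ r) hit)

module _ {n : ℕ} (H : Graph n) {r x : Fin n} (r≢x : r ≢ x) where

  private
    _~_ : Fin n → Fin n → Set
    _~_ = AdjOrEdge H r x

    ~-irrefl : ∀ {u} → ¬ (u ~ u)
    ~-irrefl (inj₁ uu)             = Adj⇒≢ H uu refl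
    ~-irrefl (inj₂ (inj₁ (refl , u≡x))) = r≢x u≡x
    ~-irrefl (inj₂ (inj₂ (refl , u≡r))) = r≢x (sym u≡r)

    edge-chain : ∀ {u v w} → IsEdge r x u v → IsEdge r x v w → w ≡ u
    edge-chain (inj₁ (refl , refl)) (inj₁ (x≡r , _))  = ⊥-elim (r≢x (sym x≡r))
    edge-chain (inj₁ (refl , refl)) (inj₂ (_ , w≡r))  = w≡r
    edge-chain (inj₂ (refl , refl)) (inj₁ (_ , w≡x))  = w≡x
    edge-chain (inj₂ (refl , refl)) (inj₂ (r≡x , _))  = ⊥-elim (r≢x r≡x)

    edge-opposite : ∀ {a v b w} → IsEdge r x a v → IsEdge r x b w → b ≡ a ⊎ b ≡ v
    edge-opposite (inj₁ (refl , refl)) (inj₁ (b≡r , _)) = inj₁ b≡r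
    edge-opposite (inj₁ (refl , refl)) (inj₂ (b≡x , _)) = inj₂ b≡x
    edge-opposite (inj₂ (refl , refl)) (inj₁ (b≡r , _)) = inj₂ b≡r
    edge-opposite (inj₂ (refl , refl)) (inj₂ (b≡x , _)) = inj₁ b≡x

    not-edge : ∀ {u v} → ¬ IsEdge r x u v → u ~ v → Adj H u v
    not-edge _      (inj₁ uv) = uv
    not-edge ¬edge (inj₂ e)   = ⊥-elim (¬edge e)

    triangle-through-edge : ∀ {u v w} → IsEdge r x u v → v ~ w → w ~ u → Path₂₃ H r x
    triangle-through-edge {u} {v} {w} uv vw wu
      with not-edge (λ e → ~-irrefl (subst (_~ u) (edge-chain uv e) wu)) vw
         | not-edge (λ e → ~-irrefl (subst (v ~_) (sym (edge-chain e uv)) vw)) wu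
    ... | vw′ | wu′ with uv
    ...   | inj₁ (refl , refl) = inj₁ (w , Adj-sym H wu′ , Adj-sym H vw′)
    ...   | inj₂ (refl , refl) = inj₁ (w , vw′ , wu′)

    square-through-edge : ∀ {a v b w} → a ≢ b → v ≢ w →
      IsEdge r x a v → v ~ b → b ~ w → w ~ a → Path₂₃ H r x
    square-through-edge {a} {v} {b} {w} a≢b v≢w av vb bw wa
      with not-edge (λ e → a≢b (sym (edge-chain av e))) vb
         | not-edge (λ e → [ a≢b ∘ sym , (λ b≡v → ~-irrefl (subst (v ~_) b≡v vb)) ] (edge-opposite av e)) bw
         | not-edge (λ e → v≢w (edge-chain e av)) wa
    ... | vb′ | bw′ | wa′ with av
    ...   | inj₁ (refl , refl) = inj₂ (w , b , Adj-sym H wa′ , Adj-sym H bw′ , Adj-sym H vb′)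
    ...   | inj₂ (refl , refl) = inj₂ (b , w , vb′ , bw′ , wa′)

  path-of-triangle : ¬ Triangle (Adj H) → Triangle (AdjOrEdge H r x) → Path₂₃ H r x
  path-of-triangle _ (a , b , c , inj₂ ab , bc , ca) = triangle-through-edge ab bc ca
  path-of-triangle _ (a , b , c , ab , inj₂ bc , ca) = triangle-through-edge bc ca ab
  path-of-triangle _ (a , b , c , ab , bc , inj₂ ca) = triangle-through-edge ca ab bc
  path-of-triangle no-triangle (a , b , c , inj₁ ab , inj₁ bc , inj₁ ca) =
    ⊥-elim (no-triangle (a , b , c , ab , bc , ca))

  path-of-square : ¬ Square (Adj H) → Square (AdjOrEdge H r x) → Path₂₃ H r x
  path-of-square no-square (a , v , b , w , a≢b , v≢w , inj₂ av , vb , bw , wa) =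
    square-through-edge a≢b v≢w av vb bw wa
  path-of-square no-square (a , v , b , w , a≢b , v≢w , av , inj₂ vb , bw , wa) =
    square-through-edge v≢w (a≢b ∘ sym) vb bw wa av
  path-of-square no-square (a , v , b , w , a≢b , v≢w , av , vb , inj₂ bw , wa) =
    square-through-edge (a≢b ∘ sym) (v≢w ∘ sym) bw wa av vb
  path-of-square no-square (a , v , b , w , a≢b , v≢w , av , vb , bw , inj₂ wa) =
    square-through-edge (v≢w ∘ sym) a≢b wa av vb bw
  path-of-square no-square (a , v , b , w , a≢b , v≢w , inj₁ av , inj₁ vb , inj₁ bw , inj₁ wa) =
    ⊥-elim (no-square (a , v , b , w , a≢b , v≢w , av , vb , bw , wa))

path₂₃-of-deletion-coloring : ∀ {M j} (G : Graph (suc M)) →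
  ¬ Triangle (Adj (complement G)) → ¬ Square (Adj (complement G)) →
  ∀ {r x} → Adj G r x → j < M → StarColorable (deleteEdge G r x) j → Path₂₃ (complement G) r x
path₂₃-of-deletion-coloring G no-triangle no-square {r} {x} rx j<M (_ , star)
  with few-colors⇒complement-triangle-or-square (deleteEdge G r x) j<M star
... | inj₁ triangle =
  path-of-triangle (complement G) (Adj⇒≢ G rx) no-triangle (Triangle-map (complement-deleteEdge G r x) triangle)
... | inj₂ square =
  path-of-square (complement G) (Adj⇒≢ G rx) no-square (Square-map (complement-deleteEdge G r x) square)

m+n+o≡p⇒p∸o∸n≡m : ∀ a b c {d} → a + b + c ≡ d → d ∸ c ∸ b ≡ a
m+n+o≡p⇒p∸o∸n≡m a b c refl = trans (cong (_∸ b) (m+n∸n≡m (a + b) c)) (m+n∸n≡m a b)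

square-below-cube : ∀ n S Q .⦃ _ : NonZero n ⦄ → S * S ≤ n * Q → Q + n ≤ n * n → S * S < n * n * n
square-below-cube n S Q S²≤nQ Q+n≤n² = begin-strict
  S * S         ≤⟨ S²≤nQ ⟩
  n * Q         <⟨ *-monoʳ-< n (m<m+n Q (>-nonZero⁻¹ n)) ⟩
  n * (Q + n)   ≤⟨ *-monoʳ-≤ n Q+n≤n² ⟩
  n * (n * n)   ≡⟨ *-assoc n n n ⟨
  n * n * n     ∎
  where open ≤-Reasoning

upper-bound-arithmetic : ∀ k S m → S + 2 * m + suc (suc k) ≡ suc (suc k) * suc (suc k) →
  2 * suc k ≤ S → 2 * m ≤ suc k * k
upper-bound-arithmetic k S m total 2[n-1]≤S = +-cancelʳ-≤ (2 * suc k + n) (2 * m) (suc k * k) (begin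
  2 * m + (2 * suc k + n)  ≤⟨ +-monoʳ-≤ (2 * m) (+-monoˡ-≤ n 2[n-1]≤S) ⟩
  2 * m + (S + n)          ≡⟨ reorder S (2 * m) n ⟩
  S + 2 * m + n            ≡⟨ total ⟩
  n * n                    ≡⟨ expand k ⟩
  suc k * k + (2 * suc k + n) ∎)
  where
  open ≤-Reasoning
  n : ℕ
  n = suc (suc k)
  reorder : ∀ a b c → b + (a + c) ≡ a + b + c
  reorder = solve-∀
  expand : ∀ k → suc (suc k) * suc (suc k) ≡ suc k * k + (2 * suc k + suc (suc k))
  expand = solve-∀

mainTheorem4 : (n : ℕ) → 5 ≤ n → (G : Graph n) → Connected G →
    Critical G (n ∸ 1) →
    ((n * n ∸ n ∸ 2 * numEdges G) <√ (n * n * n)) ×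
    (2 * numEdges G ≤ (n ∸ 1) * (n ∸ 2))
mainTheorem4 (suc (suc k)) (s≤s (s≤s _)) G _ ((_ , minimal) , critical) = lower , upper
  where
  n : ℕ
  n = suc (suc k)
  H : Graph n
  H = complement G
  no-fewer-colors : ¬ StarColorable G k
  no-fewer-colors coloring = 1+n≰n (minimal k coloring)
  no-triangle : ¬ Triangle (Adj H)
  no-triangle = no-fewer-colors ∘ star-colorable-of-complement-triangle G
  no-square : ¬ Square (Adj H)
  no-square = no-fewer-colors ∘ star-colorable-of-complement-square G
  near-root : ∀ x → x ≢ fzero → Adj H fzero x ⊎ Path₂₃ H fzero x
  near-root x x≢0 with adjacent-or-complement G (x≢0 ∘ sym)
  ... | inj₂ 0x = inj₁ 0x
  ... | inj₁ 0x with j , ((coloring , _) , j<n-1) ← critical fzero x 0x =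
    inj₂ (path₂₃-of-deletion-coloring G no-triangle no-square 0x j<n-1 coloring)
  S : ℕ
  S = sumFin n (degree H)
  total : S + 2 * numEdges G + n ≡ n * n
  total = degree-sum-complement G
  lower : (n * n ∸ n ∸ 2 * numEdges G) <√ (n * n * n)
  lower = subst (_<√ (n * n * n)) (sym (m+n+o≡p⇒p∸o∸n≡m S (2 * numEdges G) n total))
    (square-below-cube n S _ (cauchy-schwarz n (degree H)) (degree²-bound H no-triangle no-square))
  upper : 2 * numEdges G ≤ suc k * k
  upper = upper-bound-arithmetic k S (numEdges G) total (degree-sum-within-3 H near-root)
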